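{- For every $n\ge0$ and every permutation $\pi\in\mathfrak S_n$, $\phi(\pi)=\psi(\pi^{ -1})$.
   Context: $\mathfrak S_n$ is the symmetric group on $[n]$ in one-line notation; $\mathfrak S_0=\{\emptyset\}$. For $n\ge1$, $Y_n$ is the set of planar binary trees with $n$ internal nodes ($n+1$ leaves ordered left to right); $Y_0=\{\ast\}$, the trivial one-vertex tree. For $T_1\in Y_p,T_2\in Y_q$, $T_1\vee T_2$ is the tree with a new root having left subtree $T_1$ and right subtree $T_2$. Let $t\in Y_1$ be the 2-corolla; $T\triangleleft_i t$ denotes grafting $t$ onto the $i$-th leaf of $T$. $\mathrm{std}(a)$ is the standardization of a word $a$ of distinct integers ($\mathrm{std}(\emptyset)=\emptyset$). Tonks' vertex map $\phi:\mathfrak S_n\to Y_n$ (restriction to vertices of Tonks' projection from the permutohedron to the associahedron): $\phi(\emptyset)=\ast$, $\phi(1)=t$, and $\phi(\pi)=\phi(\mathrm{std}(\pi_2\cdots\pi_n))\triangleleft_{\pi_1}t$ for $n>1$. Loday–Ronco map $\psi:\mathfrak S_n\to Y_n$: $\psi(\emptyset)=\ast$; for $n>0$ write $\pi=\pi_L\,n\,\pi_R$ and set $\psi(\pi)=\psi(\mathrm{std}(\pi_L))\vee\psi(\mathrm{std}(\pi_R))$. -}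

module Defs where

open import Data.Nat using (ℕ; zero; suc; _<ᵇ_; _≤ᵇ_; _∸_; _+_; _≟_; _<?_)
open import Data.Bool using (if_then_else_)
open import Data.List using (List; []; _∷_; map; length; span; filter)
open import Data.Product using (_,_)
open import Data.Fin using (Fin; toℕ)
open import Data.Fin.Permutation using (Permutation′; _⟨$⟩ʳ_)
open import Data.List using (allFin)
open import Relation.Nullary using (¬?)

-- Planar binary trees; Y_n = trees with n internal nodes.
-- leaf is the trivial one-vertex tree ∗, and  l ∨ r  is the tree with a
-- new root whose left subtree is l and right subtree is r.
data Tree : Set where
  leaf : Tree
  _∨_  : Tree → Tree → Tree

infixr 5 _∨_

t : Tree
t = leaf ∨ leaf

leaves : Tree → ℕ
leaves leaf    = 1
leaves (l ∨ r) = leaves l + leaves r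

-- T ◁ i t : graft the corolla t onto the i-th leaf of T (leaves numbered
-- 1, 2, … from left to right)
graft : Tree → ℕ → Tree
graft leaf i = if i Data.Nat.≡ᵇ 1 then t else leaf
graft (l ∨ r) i =
  if i ≤ᵇ leaves l then graft l i ∨ r else l ∨ graft r (i ∸ leaves l)

std : List ℕ → List ℕ
std a = map (λ x → suc (length (filter (_<? x) a))) a

-- Tonks' vertex map on words (one-line notation), with fuel ≥ length
phiF : ℕ → List ℕ → Tree
phiF _       []           = leaf
phiF _       (x ∷ [])     = t
phiF zero    (x ∷ y ∷ ys) = leaf
phiF (suc k) (x ∷ y ∷ ys) = graft (phiF k (std (y ∷ ys))) x

phi : List ℕ → Tree
phi π = phiF (length π) π

-- Loday–Ronco map on words (one-line notation), with fuel ≥ length: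
-- write π = π_L n π_R (n = length π) and recurse on std π_L, std π_R
psiF : ℕ → List ℕ → Tree
psiF _       []       = leaf
psiF zero    (_ ∷ _)  = leaf
psiF (suc k) π@(_ ∷ _) with span (λ x → ¬? (x ≟ length π)) π
... | (πL , [])       = leaf   -- impossible for a permutation
... | (πL , _ ∷ πR)   = psiF k (std πL) ∨ psiF k (std πR)

psi : List ℕ → Tree
psi π = psiF (length π) π

oneLine : ∀ {n} → Permutation′ n → List ℕ
oneLine {n} π = map (λ i → suc (toℕ (π ⟨$⟩ʳ i))) (allFin n)

module Submission where

-- Read π as the set of points (π(i), i) with key π(i) and priority i. Both trees are the treap
-- (Cartesian tree) of this set: the binary search tree on the keys in which every node has
-- larger priority than its descendants. It is unique once priorities are distinct.
-- Tonks' φ builds it by insertion: π₁ has the least priority, so it is a new leaf, grafted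
-- at the slot that its key occupies among the remaining keys. The Loday–Ronco map applied to
-- π⁻¹ sees the same points listed by key with priority π⁻¹(j): its root is the letter n, the
-- point of largest priority, and its subtrees are built from the points to the left and right.
-- Standardization renames keys or priorities monotonically and so does not change the treap.

open import Defs
open import Data.Nat using (ℕ)
open import Data.Fin.Permutation using (Permutation′; flip)
open import Relation.Binary.PropositionalEquality using (_≡_)

import Algebra.Properties.CommutativeMonoid.Sum as CommutativeMonoidSum
open import Data.Bool.Base using (true; false; if_then_else_)
open import Data.Fin.Base as Fin using (Fin; toℕ)
open import Data.Fin.Permutation using (_⟨$⟩ʳ_; _⟨$⟩ˡ_; inverseˡ; inverseʳ)
open import Data.Fin.Properties using (toℕ<n; toℕ-injective)
open import Data.List.Base using (List; []; _∷_; _++_; map; filter; length; span; tabulate; allFin)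
open import Data.List.Membership.Propositional using (_∈_)
open import Data.List.Membership.Propositional.Properties
  using (∈-++⁺ˡ; ∈-++⁺ʳ; ∈-++⁻; ∈-tabulate⁺; ∈-tabulate⁻)
open import Data.List.Properties
  using ( length-++; length-map; length-filter; map-++; map-∘; map-cong; map-cong-local
        ; map-tabulate; filter-++; filter-all; filter-none; filter-accept; filter-reject)
open import Data.List.Relation.Binary.Permutation.Propositional
  using (_↭_; prep; swap; ↭-refl; ↭-sym; ↭-trans)
open import Data.List.Relation.Binary.Permutation.Propositional.Properties
  using (filter-↭; ↭-length; ∈-resp-↭; All-resp-↭; shift; ++⁺ˡ)
open import Data.List.Relation.Binary.Sublist.Propositional using (⊆-refl)
open import Data.List.Relation.Binary.Sublist.Propositional.Properties
  using (filter⁺; length-mono-≤)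
open import Data.List.Relation.Binary.Subset.Propositional using (_⊆_)
open import Data.List.Relation.Unary.All as All using (All; []; _∷_)
open import Data.List.Relation.Unary.All.Properties using (++⁺; ++⁻; ++⁻ˡ; ++⁻ʳ; map⁺)
open import Data.List.Relation.Unary.AllPairs using (AllPairs; []; _∷_)
open import Data.List.Relation.Unary.AllPairs.Properties using (tabulate⁺; tabulate⁺-<)
open import Data.List.Relation.Unary.Any using (here; there)
open import Data.Nat.Base using (zero; suc; _+_; _≤_; _<_; s≤s)
open import Data.Nat.Properties
  using ( _≟_; _≤?_; _<?_; ≤-refl; ≤-trans; ≤-pred; ≤-reflexive; ≤-antisym
        ; <-irrefl; <-asym; <-trans; <-cmp; <⇒≤; <⇒≢; m<n⇒m<1+n; m≤m+n; m≤n+m; m+1+n≰m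
        ; m+n∸m≡n; +-suc; +-identityʳ; suc-injective; +-0-commutativeMonoid)
open import Data.Product using (_×_; _,_; proj₁; proj₂; map₁)
open import Data.Sum using (inj₁; inj₂)
open import Function.Base using (_∘_)
open import Function.Bundles using (Injection)
open import Function.Properties.Inverse using (↔⇒↣)
open import Level using (Level)
open import Relation.Binary.Core using (Rel)
open import Relation.Binary.Definitions using (tri<; tri≈; tri>)
open import Relation.Binary.PropositionalEquality
  using (_≢_; refl; sym; trans; cong; cong₂; subst; module ≡-Reasoning)
open import Relation.Nullary using (Dec; does; yes; no; ¬_; ¬?; contradiction)
open import Relation.Nullary.Decidable using (dec-true; dec-false)
open import Relation.Unary using (Pred; Decidable)

open CommutativeMonoidSum +-0-commutativeMonoid using (sum; sum-permute; sum-replicate-zero)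

private
  variable
    a ℓ ℓ′ : Level
    A B : Set a

count : {P : Pred A ℓ} → Decidable P → List A → ℕ
count P? xs = length (filter P? xs)

indicator : Dec A → ℕ
indicator A? = if does A? then 1 else 0

module _ {P : Pred A ℓ} (P? : Decidable P) where

  count-↭ : ∀ {xs ys} → xs ↭ ys → count P? xs ≡ count P? ys
  count-↭ xs↭ys = ↭-length (filter-↭ P? xs↭ys)

  count-++ : ∀ xs ys → count P? (xs ++ ys) ≡ count P? xs + count P? ys
  count-++ xs ys = trans (cong length (filter-++ P? xs ys)) (length-++ (filter P? xs))

  count-all : ∀ {xs} → All P xs → count P? xs ≡ length xs
  count-all Pxs = cong length (filter-all P? Pxs)

  count-none : ∀ {xs} → All (¬_ ∘ P) xs → count P? xs ≡ 0
  count-none ¬Pxs = cong length (filter-none P? ¬Pxs)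

  count-map : (f : B → A) (xs : List B) → count P? (map f xs) ≡ count (P? ∘ f) xs
  count-map f []       = refl
  count-map f (x ∷ xs) with does (P? (f x))
  ... | true  = cong suc (count-map f xs)
  ... | false = count-map f xs

  count-tabulate : ∀ {n} (f : Fin n → A) → count P? (tabulate f) ≡ sum (λ i → indicator (P? (f i)))
  count-tabulate {zero}  f = refl
  count-tabulate {suc n} f with does (P? (f Fin.zero))
  ... | true  = cong suc (count-tabulate (f ∘ Fin.suc))
  ... | false = count-tabulate (f ∘ Fin.suc)

module _ {P : Pred A ℓ} {Q : Pred A ℓ′} (P? : Decidable P) (Q? : Decidable Q) where

  count-≐-on : ∀ xs → (∀ {x} → x ∈ xs → P x → Q x) → (∀ {x} → x ∈ xs → Q x → P x) →
               count P? xs ≡ count Q? xs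
  count-≐-on []       _   _   = refl
  count-≐-on (x ∷ xs) P⇒Q Q⇒P with P? x | Q? x
  ... | yes _   | yes _   = cong suc (count-≐-on xs (P⇒Q ∘ there) (Q⇒P ∘ there))
  ... | yes Px  | no  ¬Qx = contradiction (P⇒Q (here refl) Px) ¬Qx
  ... | no  ¬Px | yes Qx  = contradiction (Q⇒P (here refl) Qx) ¬Px
  ... | no  _   | no  _   = count-≐-on xs (P⇒Q ∘ there) (Q⇒P ∘ there)

  module _ (P⇒Q : ∀ {x} → P x → Q x) where

    count-mono : ∀ xs → count P? xs ≤ count Q? xs
    count-mono xs = length-mono-≤ (filter⁺ P? Q? (λ { refl → P⇒Q }) (⊆-refl {x = xs}))

    count-mono-< : ∀ {xs z} → z ∈ xs → Q z → ¬ P z → count P? xs < count Q? xs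
    count-mono-< {x ∷ xs} (here refl) Qx ¬Px with P? x | Q? x
    ... | yes Px | _      = contradiction Px ¬Px
    ... | no _   | yes _  = s≤s (count-mono xs)
    ... | no _   | no ¬Qx = contradiction Qx ¬Qx
    count-mono-< {x ∷ xs} (there z∈xs) Qz ¬Pz with P? x | Q? x
    ... | yes _  | yes _  = s≤s (count-mono-< z∈xs Qz ¬Pz)
    ... | yes Px | no ¬Qx = contradiction (P⇒Q Px) ¬Qx
    ... | no _   | yes _  = m<n⇒m<1+n (count-mono-< z∈xs Qz ¬Pz)
    ... | no _   | no _   = count-mono-< z∈xs Qz ¬Pz

rank : List ℕ → ℕ → ℕ
rank ws x = suc (count (_<? x) ws)

count-<-self : ∀ x ws → count (_<? x) (x ∷ ws) ≡ count (_<? x) ws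
count-<-self x ws = cong length (filter-reject (_<? x) (<-irrefl refl))

rank-∷-self : ∀ x ws → rank (x ∷ ws) x ≡ rank ws x
rank-∷-self x ws = cong suc (count-<-self x ws)

rank-strictMono : ∀ {ws x y} → x ∈ ws → x < y → rank ws x < rank ws y
rank-strictMono {x = x} {y} x∈ws x<y =
  s≤s (count-mono-< (_<? x) (_<? y) (λ z<x → <-trans z<x x<y) x∈ws x<y (<-irrefl refl))

StrictMonoOn : List ℕ → (ℕ → ℕ) → Set
StrictMonoOn ws g = ∀ {x y} → x ∈ ws → y ∈ ws → x < y → g x < g y

strictMonoOn-reflects-< : ∀ {ws g} → StrictMonoOn ws g →
                          ∀ {x y} → x ∈ ws → y ∈ ws → g x < g y → x < y
strictMonoOn-reflects-< mono {x} {y} x∈ws y∈ws gx<gy with <-cmp x y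
... | tri< x<y _ _  = x<y
... | tri≈ _ refl _ = contradiction gx<gy (<-irrefl refl)
... | tri> _ _ y<x  = contradiction (mono y∈ws x∈ws y<x) (<-asym gx<gy)

std-map-strictMonoOn : ∀ {ws g} → StrictMonoOn ws g → std (map g ws) ≡ std ws
std-map-strictMonoOn {ws} {g} mono = begin
  map (rank (map g ws)) (map g ws) ≡⟨ map-∘ ws ⟨
  map (rank (map g ws) ∘ g) ws     ≡⟨ map-cong-local (All.tabulate rank-map) ⟩
  map (rank ws) ws                 ∎
  where
  open ≡-Reasoning
  rank-map : ∀ {x} → x ∈ ws → rank (map g ws) (g x) ≡ rank ws x
  rank-map {x} x∈ws = cong suc (trans (count-map (_<? g x) g ws)
    (count-≐-on _ (_<? x) ws (λ y∈ws → strictMonoOn-reflects-< mono y∈ws x∈ws)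
                             (λ y∈ws → mono y∈ws x∈ws)))

letter : ∀ {n} → Permutation′ n → Fin n → ℕ
letter ρ i = suc (toℕ (ρ ⟨$⟩ʳ i))

oneLine-tabulate : ∀ {n} (ρ : Permutation′ n) → oneLine ρ ≡ tabulate (letter ρ)
oneLine-tabulate ρ = map-tabulate (λ i → i) (letter ρ)

letter-≢ : ∀ {n} (ρ : Permutation′ n) {i j} → i ≢ j → letter ρ i ≢ letter ρ j
letter-≢ ρ i≢j = i≢j ∘ Injection.injective (↔⇒↣ ρ) ∘ toℕ-injective ∘ suc-injective

sum-indicator-< : ∀ {n c} → c ≤ n → sum {n} (λ j → indicator (toℕ j <? c)) ≡ c
sum-indicator-< {n}     {zero}  _         = sum-replicate-zero n
sum-indicator-< {suc n} {suc c} (s≤s c≤n) = cong suc (sum-indicator-< c≤n)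

count-oneLine-< : ∀ {n c} (ρ : Permutation′ n) → c ≤ n → count (_<? suc c) (oneLine ρ) ≡ c
count-oneLine-< {n} {c} ρ c≤n = begin
  count (_<? suc c) (map (letter ρ) (allFin n))   ≡⟨ count-map (_<? suc c) (letter ρ) (allFin n) ⟩
  count letter<? (allFin n)                       ≡⟨ count-tabulate letter<? (λ i → i) ⟩
  sum {n} (λ i → indicator (toℕ (ρ ⟨$⟩ʳ i) <? c)) ≡⟨ sum-permute (λ j → indicator (toℕ j <? c)) ρ ⟨
  sum {n} (λ j → indicator (toℕ j <? c))          ≡⟨ sum-indicator-< c≤n ⟩
  c                                               ∎
  where
  open ≡-Reasoning
  letter<? : (i : Fin n) → Dec (letter ρ i < suc c)
  letter<? i = letter ρ i <? suc c

std-oneLine : ∀ {n} (ρ : Permutation′ n) → std (oneLine ρ) ≡ oneLine ρ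
std-oneLine {n} ρ = begin
  map (rank (oneLine ρ)) (map (letter ρ) (allFin n)) ≡⟨ map-∘ (allFin n) ⟨
  map (rank (oneLine ρ) ∘ letter ρ) (allFin n)       ≡⟨ map-cong rank-letter (allFin n) ⟩
  map (letter ρ) (allFin n)                          ∎
  where
  open ≡-Reasoning
  rank-letter : ∀ i → rank (oneLine ρ) (letter ρ i) ≡ letter ρ i
  rank-letter i = cong suc (count-oneLine-< ρ (<⇒≤ (toℕ<n (ρ ⟨$⟩ʳ i))))

Point : Set
Point = ℕ × ℕ

key prio : Point → ℕ
key  = proj₁
prio = proj₂

_<ₖ_ _<ₚ_ : Point → Point → Set
x <ₖ y = key x < key y
x <ₚ y = prio x < prio y

_<ₖ?_ : (x y : Point) → Dec (x <ₖ y)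
x <ₖ? y = key x <? key y

data IsTreap : List Point → Tree → Set where
  empty : IsTreap [] leaf
  node  : ∀ {P L R l r} p → P ↭ L ++ p ∷ R →
          All (_<ₖ p) L → All (p <ₖ_) R → All (λ x → prio x ≤ prio p) P →
          IsTreap L l → IsTreap R r → IsTreap P (l ∨ r)

module _ {P L R : List A} {x : A} (P↭LxR : P ↭ L ++ x ∷ R) where

  mid∈ : x ∈ P
  mid∈ = ∈-resp-↭ (↭-sym P↭LxR) (∈-++⁺ʳ L (here refl))

  left⊆ : L ⊆ P
  left⊆ = ∈-resp-↭ (↭-sym P↭LxR) ∘ ∈-++⁺ˡ

  right⊆ : R ⊆ P
  right⊆ = ∈-resp-↭ (↭-sym P↭LxR) ∘ ∈-++⁺ʳ L ∘ there

  All-split : ∀ {Q : Pred A ℓ} → All Q P → All Q L × Q x × All Q R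
  All-split QP with ++⁻ L (All-resp-↭ P↭LxR QP)
  ... | QL , Qx ∷ QR = QL , Qx , QR

treap-leaves : ∀ {P T} → IsTreap P T → leaves T ≡ suc (length P)
treap-leaves empty = refl
treap-leaves (node {P} {L} {R} {l} {r} p P↭LpR _ _ _ tL tR) = begin
  leaves l + leaves r             ≡⟨ cong₂ _+_ (treap-leaves tL) (treap-leaves tR) ⟩
  suc (length L) + suc (length R) ≡⟨ cong suc (length-++ L) ⟨
  suc (length (L ++ p ∷ R))       ≡⟨ cong suc (↭-length P↭LpR) ⟨
  suc (length P)                  ∎
  where open ≡-Reasoning

∈-left : ∀ {L R p x} → All (p <ₖ_) R → x <ₖ p → x ∈ L ++ p ∷ R → x ∈ L
∈-left {L} p<R x<p x∈LpR with ∈-++⁻ L x∈LpR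
... | inj₁ x∈L         = x∈L
... | inj₂ (here refl) = contradiction x<p (<-irrefl refl)
... | inj₂ (there x∈R) = contradiction x<p (<-asym (All.lookup p<R x∈R))

∈-right : ∀ {L R p x} → All (_<ₖ p) L → p <ₖ x → x ∈ L ++ p ∷ R → x ∈ R
∈-right {L} L<p p<x x∈LpR with ∈-++⁻ L x∈LpR
... | inj₁ x∈L         = contradiction p<x (<-asym (All.lookup L<p x∈L))
... | inj₂ (here refl) = contradiction p<x (<-irrefl refl)
... | inj₂ (there x∈R) = x∈R

DistinctPriorities : List Point → Set
DistinctPriorities P = ∀ {x y} → x ∈ P → y ∈ P → prio x ≡ prio y → x ≡ y

treap-unique : ∀ {P P′ T T′} → IsTreap P T → IsTreap P′ T′ → P ⊆ P′ → P′ ⊆ P →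
               DistinctPriorities P → T ≡ T′
treap-unique empty empty _ _ _ = refl
treap-unique empty (node _ σ′ _ _ _ _ _) _ P′⊆[] _ with P′⊆[] (mid∈ σ′)
... | ()
treap-unique (node _ σ _ _ _ _ _) empty P⊆[] _ _ with P⊆[] (mid∈ σ)
... | ()
treap-unique (node p σ L<p p<R p-max tL tR) (node p′ σ′ L′<p′ p′<R′ p′-max tL′ tR′)
             P⊆P′ P′⊆P distinct
  with distinct (mid∈ σ) (P′⊆P (mid∈ σ′))
         (≤-antisym (All.lookup p′-max (P⊆P′ (mid∈ σ))) (All.lookup p-max (P′⊆P (mid∈ σ′))))
... | refl = cong₂ _∨_
  (treap-unique tL tL′
    (λ x∈L  → ∈-left p′<R′ (All.lookup L<p x∈L) (∈-resp-↭ σ′ (P⊆P′ (left⊆ σ x∈L))))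
    (λ x∈L′ → ∈-left p<R (All.lookup L′<p′ x∈L′) (∈-resp-↭ σ (P′⊆P (left⊆ σ′ x∈L′))))
    (λ x∈L y∈L → distinct (left⊆ σ x∈L) (left⊆ σ y∈L)))
  (treap-unique tR tR′
    (λ x∈R  → ∈-right L′<p′ (All.lookup p<R x∈R) (∈-resp-↭ σ′ (P⊆P′ (right⊆ σ x∈R))))
    (λ x∈R′ → ∈-right L<p (All.lookup p′<R′ x∈R′) (∈-resp-↭ σ (P′⊆P (right⊆ σ′ x∈R′))))
    (λ x∈R y∈R → distinct (right⊆ σ x∈R) (right⊆ σ y∈R)))

graft-left : ∀ l r {i} → i ≤ leaves l → graft (l ∨ r) i ≡ graft l i ∨ r
graft-left l r {i} i≤ rewrite dec-true (i ≤? leaves l) i≤ = refl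

graft-right : ∀ l r i → graft (l ∨ r) (leaves l + suc i) ≡ l ∨ graft r (suc i)
graft-right l r i
  rewrite dec-false (leaves l + suc i ≤? leaves l) (m+1+n≰m (leaves l)) | m+n∸m≡n (leaves l) (suc i)
  = refl

-- In a treap T on P, the leaf number slot P q lies between the keys just below and above key q.
slot : List Point → Point → ℕ
slot P q = suc (count (_<ₖ? q) P)

slot≤leaves : ∀ {P T} q → IsTreap P T → slot P q ≤ leaves T
slot≤leaves {P} q tP rewrite treap-leaves tP = s≤s (length-filter (_<ₖ? q) P)

module _ {P L R : List Point} {p q : Point} (P↭LpR : P ↭ L ++ p ∷ R) where

  slot-left : All (p <ₖ_) R → q <ₖ p → slot P q ≡ slot L q
  slot-left p<R q<p = cong suc (begin
    below P                 ≡⟨ count-↭ (_<ₖ? q) P↭LpR ⟩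
    below (L ++ p ∷ R)      ≡⟨ count-++ (_<ₖ? q) L (p ∷ R) ⟩
    below L + below (p ∷ R) ≡⟨ cong (below L +_) (count-none (_<ₖ? q) pR≮q) ⟩
    below L + 0             ≡⟨ +-identityʳ _ ⟩
    below L                 ∎)
    where
    open ≡-Reasoning
    below : List Point → ℕ
    below = count (_<ₖ? q)
    pR≮q : All (λ x → ¬ x <ₖ q) (p ∷ R)
    pR≮q = <-asym q<p ∷ All.map (λ p<x → <-asym (<-trans q<p p<x)) p<R

  slot-right : All (_<ₖ p) L → p <ₖ q → slot P q ≡ suc (length L) + slot R q
  slot-right L<p p<q = cong suc (begin
    below P                 ≡⟨ count-↭ (_<ₖ? q) P↭LpR ⟩
    below (L ++ p ∷ R)      ≡⟨ count-++ (_<ₖ? q) L (p ∷ R) ⟩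
    below L + below (p ∷ R) ≡⟨ cong₂ _+_ (count-all (_<ₖ? q) L<q)
                                         (cong length (filter-accept (_<ₖ? q) p<q)) ⟩
    length L + slot R q     ∎)
    where
    open ≡-Reasoning
    below : List Point → ℕ
    below = count (_<ₖ? q)
    L<q : All (_<ₖ q) L
    L<q = All.map (λ x<p → <-trans x<p p<q) L<p

  graft-slot-left : ∀ {l} r → IsTreap L l → All (p <ₖ_) R → q <ₖ p →
                    graft (l ∨ r) (slot P q) ≡ graft l (slot L q) ∨ r
  graft-slot-left {l} r tL p<R q<p =
    trans (cong (graft (l ∨ r)) (slot-left p<R q<p)) (graft-left l r (slot≤leaves q tL))

  graft-slot-right : ∀ {l} r → IsTreap L l → All (_<ₖ p) L → p <ₖ q →
                     graft (l ∨ r) (slot P q) ≡ l ∨ graft r (slot R q)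
  graft-slot-right {l} r tL L<p p<q = begin
    graft (l ∨ r) (slot P q)                  ≡⟨ cong (graft (l ∨ r)) (slot-right L<p p<q) ⟩
    graft (l ∨ r) (suc (length L) + slot R q) ≡⟨ cong (λ m → graft (l ∨ r) (m + slot R q)) leaves-l ⟨
    graft (l ∨ r) (leaves l + slot R q)       ≡⟨ graft-right l r _ ⟩
    l ∨ graft r (slot R q)                    ∎
    where
    open ≡-Reasoning
    leaves-l : leaves l ≡ suc (length L)
    leaves-l = treap-leaves tL

graft-insert : ∀ {P T} q → IsTreap P T → All (q <ₚ_) P → All (λ x → key q ≢ key x) P →
               IsTreap (q ∷ P) (graft T (slot P q))
graft-insert q empty [] [] = node q ↭-refl [] [] (≤-refl ∷ []) empty empty
graft-insert {P} q (node {L = L} {R} {l} {r} p σ L<p p<R p-max tL tR) q<P q≢P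
  with All-split σ q<P | All-split σ q≢P | <-cmp (key q) (key p)
... | _ , _ , _ | _ , q≢p , _ | tri≈ _ q≡p _ = contradiction q≡p q≢p
... | q<L , q<p , _ | q≢L , _ , _ | tri< q<ₖp _ _
  rewrite graft-slot-left {q = q} σ r tL p<R q<ₖp
  = node p (prep q σ) (q<ₖp ∷ L<p) p<R (<⇒≤ q<p ∷ p-max) (graft-insert q tL q<L q≢L) tR
... | _ , q<p , q<R | _ , _ , q≢R | tri> _ _ p<ₖq
  rewrite graft-slot-right {q = q} σ r tL L<p p<ₖq
  = node p q∷P↭LpqR L<p (p<ₖq ∷ p<R) (<⇒≤ q<p ∷ p-max) tL (graft-insert q tR q<R q≢R)
  where
  q∷P↭LpqR : q ∷ P ↭ L ++ p ∷ q ∷ R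
  q∷P↭LpqR = ↭-trans (prep q σ) (↭-trans (↭-sym (shift q L (p ∷ R))) (++⁺ˡ L (swap q p ↭-refl)))

phiF-std-∷ : ∀ k x y w →
             phiF (suc k) (std (x ∷ y ∷ w)) ≡ graft (phiF k (std (y ∷ w))) (rank (y ∷ w) x)
phiF-std-∷ k x y w = cong₂ graft
  (cong (phiF k) (std-map-strictMonoOn {y ∷ w} (λ u∈yw _ → rank-strictMono (there u∈yw))))
  (rank-∷-self x (y ∷ w))

phiF-isTreap : ∀ k Q → AllPairs _<ₚ_ Q → AllPairs (λ x y → key x ≢ key y) Q → length Q ≤ k →
               IsTreap Q (phiF k (std (map key Q)))
phiF-isTreap k       []                _            _                _         = empty
phiF-isTreap k       (q ∷ [])          _            _                _         =
  graft-insert q empty [] []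
phiF-isTreap (suc k) (q ∷ Q@(q′ ∷ Q′)) (q<Q ∷ incr) (q≢Q ∷ distinct) (s≤s len) =
  subst (IsTreap (q ∷ Q)) (sym tree-eq)
    (graft-insert q (phiF-isTreap k Q incr distinct len) q<Q q≢Q)
  where
  tree-eq : phiF (suc k) (std (map key (q ∷ Q))) ≡ graft (phiF k (std (map key Q))) (slot Q q)
  tree-eq = trans (phiF-std-∷ k (key q) (key q′) (map key Q′))
                  (cong (graft (phiF k (std (map key Q))) ∘ suc) (count-map (_<? key q) key Q))

break-at : ∀ {m n} A B → All (_≢ n) A → n ≡ m →
           span (λ x → ¬? (x ≟ m)) (A ++ n ∷ B) ≡ (A , n ∷ B)
break-at {m} {n} []      B []          n≡m rewrite dec-true (n ≟ m) n≡m = refl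
break-at {m}     (a ∷ A) B (a≢n ∷ A≢n) n≡m
  rewrite dec-false (a ≟ m) (λ a≡m → a≢n (trans a≡m (sym n≡m)))
  = cong (map₁ (a ∷_)) (break-at A B A≢n n≡m)

psiF-span : ∀ k x xs {A y B} → span (λ z → ¬? (z ≟ length (x ∷ xs))) (x ∷ xs) ≡ (A , y ∷ B) →
            psiF (suc k) (x ∷ xs) ≡ psiF k (std A) ∨ psiF k (std B)
psiF-span k x xs eq rewrite eq = refl

psiF-step : ∀ k A n B → All (_≢ n) A → n ≡ length (A ++ n ∷ B) →
            psiF (suc k) (A ++ n ∷ B) ≡ psiF k (std A) ∨ psiF k (std B)
psiF-step k []      n B A≢n n≡len = psiF-span k n B (break-at [] B A≢n n≡len)
psiF-step k (a ∷ A) n B A≢n n≡len = psiF-span k a (A ++ n ∷ B) (break-at (a ∷ A) B A≢n n≡len)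

count-<-max : ∀ {m} A B → All (_< m) A → All (_< m) B →
              count (_<? m) (A ++ m ∷ B) ≡ length A + length B
count-<-max {m} A B A<m B<m = begin
  below (A ++ m ∷ B)      ≡⟨ count-++ (_<? m) A (m ∷ B) ⟩
  below A + below (m ∷ B) ≡⟨ cong (below A +_) (count-<-self m B) ⟩
  below A + below B       ≡⟨ cong₂ _+_ (count-all (_<? m) A<m) (count-all (_<? m) B<m) ⟩
  length A + length B     ∎
  where
  open ≡-Reasoning
  below : List ℕ → ℕ
  below = count (_<? m)

psiF-std-max : ∀ k A m B → All (_< m) A → All (_< m) B →
               psiF (suc k) (std (A ++ m ∷ B)) ≡ psiF k (std A) ∨ psiF k (std B)
psiF-std-max k A m B A<m B<m = begin
  psiF (suc k) (map ρ W)                          ≡⟨ cong (psiF (suc k)) (map-++ ρ A (m ∷ B)) ⟩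
  psiF (suc k) (map ρ A ++ ρ m ∷ map ρ B)         ≡⟨ psiF-step k _ _ _ ρA≢ρm ρm≡length ⟩
  psiF k (std (map ρ A)) ∨ psiF k (std (map ρ B)) ≡⟨ cong₂ (λ u v → psiF k u ∨ psiF k v)
                                                       (std-map-strictMonoOn monoA)
                                                       (std-map-strictMonoOn monoB) ⟩
  psiF k (std A) ∨ psiF k (std B)                 ∎
  where
  open ≡-Reasoning
  W = A ++ m ∷ B
  ρ = rank W
  monoA : StrictMonoOn A ρ
  monoA x∈A _ = rank-strictMono (∈-++⁺ˡ x∈A)
  monoB : StrictMonoOn B ρ
  monoB x∈B _ = rank-strictMono (∈-++⁺ʳ A (there x∈B))
  ρA≢ρm : All (_≢ ρ m) (map ρ A)
  ρA≢ρm = map⁺ (All.tabulate (λ x∈A → <⇒≢ (rank-strictMono (∈-++⁺ˡ x∈A) (All.lookup A<m x∈A))))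
  ρm≡length : ρ m ≡ length (map ρ A ++ ρ m ∷ map ρ B)
  ρm≡length = begin
    suc (count (_<? m) W)             ≡⟨ cong suc (count-<-max A B A<m B<m) ⟩
    suc (length A + length B)         ≡⟨ +-suc (length A) (length B) ⟨
    length A + length (m ∷ B)         ≡⟨ length-++ A ⟨
    length W                          ≡⟨ length-map ρ W ⟨
    length (map ρ W)                  ≡⟨ cong length (map-++ ρ A (m ∷ B)) ⟩
    length (map ρ A ++ ρ m ∷ map ρ B) ∎

data MaxView : List Point → Set where
  []    : MaxView []
  split : ∀ L p R → All (_<ₚ p) L → All (_<ₚ p) R → MaxView (L ++ p ∷ R)

maxView : ∀ P → AllPairs (λ x y → prio x ≢ prio y) P → MaxView P
maxView []      []               = []
maxView (a ∷ P) (a≢P ∷ distinct) with maxView P distinct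
... | [] = split [] a [] [] []
... | split L p R L<p R<p with <-cmp (prio a) (prio p)
...   | tri< a<p _ _ = split (a ∷ L) p R (a<p ∷ L<p) R<p
...   | tri≈ _ a≡p _ = contradiction a≡p (All.lookup a≢P (∈-++⁺ʳ L (here refl)))
...   | tri> _ _ p<a = split [] a (L ++ p ∷ R) [] (++⁺ (below-a L<p) (p<a ∷ below-a R<p))
  where
  below-a : ∀ {xs} → All (_<ₚ p) xs → All (_<ₚ a) xs
  below-a = All.map (λ x<p → <-trans x<p p<a)

AllPairs-split : ∀ {R : Rel A ℓ} L {x M} → AllPairs R (L ++ x ∷ M) →
                 All (λ y → R y x) L × All (R x) M × AllPairs R L × AllPairs R M
AllPairs-split []      (xM ∷ M!)     = [] , xM , [] , M!
AllPairs-split (y ∷ L) (yLxM ∷ LxM!) with AllPairs-split L LxM!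
... | Lx , xM , L! , M! = All.head (++⁻ʳ L yLxM) ∷ Lx , xM , ++⁻ˡ L yLxM ∷ L! , M!

length-split : ∀ {k} (L : List A) {x M} → length (L ++ x ∷ M) ≤ k → length L < k × length M < k
length-split {k = k} L {M = M} len =
  ≤-trans L<LxM LxM≤k , ≤-trans (m≤n+m (suc (length M)) (length L)) LxM≤k
  where
  LxM≤k : length L + suc (length M) ≤ k
  LxM≤k = subst (_≤ k) (length-++ L) len
  L<LxM : length L < length L + suc (length M)
  L<LxM = subst (length L <_) (sym (+-suc (length L) (length M)))
                (s≤s (m≤m+n (length L) (length M)))

psiF-isTreap : ∀ k P → AllPairs _<ₖ_ P → AllPairs (λ x y → prio x ≢ prio y) P → length P ≤ k →
               IsTreap P (psiF k (std (map prio P)))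
psiF-isTreap k P incr distinct len with maxView P distinct
... | [] = empty
psiF-isTreap zero    _ _ _ len | split L p R _ _ = contradiction (proj₁ (length-split L len)) λ ()
psiF-isTreap (suc k) _ incr distinct len | split L p R L<p R<p
  with AllPairs-split L incr | AllPairs-split L distinct | length-split L len
... | L<ₖp , p<ₖR , incrL , incrR | _ , _ , distinctL , distinctR | lenL , lenR =
  subst (IsTreap (L ++ p ∷ R)) (sym tree-eq)
    (node p ↭-refl L<ₖp p<ₖR p-max (psiF-isTreap k L incrL distinctL (≤-pred lenL))
                                   (psiF-isTreap k R incrR distinctR (≤-pred lenR)))
  where
  p-max : All (λ x → prio x ≤ prio p) (L ++ p ∷ R)
  p-max = ++⁺ (All.map <⇒≤ L<p) (≤-refl ∷ All.map <⇒≤ R<p)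
  tree-eq : psiF (suc k) (std (map prio (L ++ p ∷ R)))
          ≡ psiF k (std (map prio L)) ∨ psiF k (std (map prio R))
  tree-eq = trans (cong (psiF (suc k) ∘ std) (map-++ prio L (p ∷ R)))
                  (psiF-std-max k (map prio L) (prio p) (map prio R) (map⁺ L<p) (map⁺ R<p))

module _ {n : ℕ} (π : Permutation′ n) where

  byPosition : List Point
  byPosition = tabulate (λ i → letter π i , suc (toℕ i))

  byValue : List Point
  byValue = tabulate (λ j → suc (toℕ j) , letter (flip π) j)

  byPosition⊆byValue : byPosition ⊆ byValue
  byPosition⊆byValue x∈ with ∈-tabulate⁻ x∈
  ... | i , refl = subst (λ j → (letter π i , suc (toℕ j)) ∈ byValue) (inverseˡ π)
                         (∈-tabulate⁺ (π ⟨$⟩ʳ i))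

  byValue⊆byPosition : byValue ⊆ byPosition
  byValue⊆byPosition y∈ with ∈-tabulate⁻ y∈
  ... | j , refl = subst (λ i → (suc (toℕ i) , letter (flip π) j) ∈ byPosition) (inverseʳ π)
                         (∈-tabulate⁺ (π ⟨$⟩ˡ j))

  byPosition-distinctPriorities : DistinctPriorities byPosition
  byPosition-distinctPriorities x∈ y∈ prio≡ with ∈-tabulate⁻ x∈ | ∈-tabulate⁻ y∈
  ... | i , refl | j , refl with toℕ-injective (suc-injective prio≡)
  ... | refl = refl

  phi-isTreap : IsTreap byPosition (phi (oneLine π))
  phi-isTreap = subst (IsTreap byPosition ∘ phiF (length (oneLine π)))
                      (trans (cong std keys) (std-oneLine π))
    (phiF-isTreap _ byPosition (tabulate⁺-< s≤s) (tabulate⁺ (letter-≢ π))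
      (≤-reflexive (trans (sym (length-map key byPosition)) (cong length keys))))
    where
    keys : map key byPosition ≡ oneLine π
    keys = trans (map-tabulate _ key) (sym (oneLine-tabulate π))

  psi-isTreap : IsTreap byValue (psi (oneLine (flip π)))
  psi-isTreap = subst (IsTreap byValue ∘ psiF (length (oneLine (flip π))))
                      (trans (cong std prios) (std-oneLine (flip π)))
    (psiF-isTreap _ byValue (tabulate⁺-< s≤s) (tabulate⁺ (letter-≢ (flip π)))
      (≤-reflexive (trans (sym (length-map prio byValue)) (cong length prios))))
    where
    prios : map prio byValue ≡ oneLine (flip π)
    prios = trans (map-tabulate _ prio) (sym (oneLine-tabulate (flip π)))

corollary4p14 : (n : ℕ) (π : Permutation′ n) → phi (oneLine π) ≡ psi (oneLine (flip π))
corollary4p14 n π =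
  treap-unique (phi-isTreap π) (psi-isTreap π) (byPosition⊆byValue π) (byValue⊆byPosition π)
    (byPosition-distinctPriorities π)
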